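{- The class of linearly ordered sets equipped with two order preserving unary operations does not have the amalgamation property; likewise, the class of linearly ordered sets equipped with two strict order preserving unary operations does not have the amalgamation property.
   Context: A unary operation $f$ on an ordered set is order preserving if $a\le b$ implies $f(a)\le f(b)$, strict order preserving if $a<b$ implies $f(a)<f(b)$. Embeddings are injective maps commuting with all operations and satisfying $c\le d\iff \iota(c)\le\iota(d)$. A class $\mathcal K$ has the amalgamation property (AP) if whenever $\mathbf A,\mathbf B,\mathbf C\in\mathcal K$ and $\iota_1:\mathbf C\to\mathbf A$, $\iota_2:\mathbf C\to\mathbf B$ are embeddings, there exist $\mathbf D\in\mathcal K$ and embeddings $j_1:\mathbf A\to\mathbf D$, $j_2:\mathbf B\to\mathbf D$ with $j_1\circ\iota_1=j_2\circ\iota_2$. -}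

module Defs where

open import Level using (0ℓ)
open import Data.Product using (Σ; _×_; _,_)
open import Relation.Binary.Core using (Rel)
open import Relation.Binary.Structures using (IsTotalOrder)
open import Relation.Binary.PropositionalEquality using (_≡_)
open import Relation.Nullary using (¬_)
open import Function.Definitions using (Injective)

record LinOrd2 : Set₁ where
  field
    Carrier      : Set
    _≤_          : Rel Carrier 0ℓ
    isTotalOrder : IsTotalOrder _≡_ _≤_
    f            : Carrier → Carrier
    g            : Carrier → Carrier

  _<_ : Rel Carrier 0ℓ
  a < b = (a ≤ b) × ¬ (a ≡ b)

open LinOrd2

OrderPreserving : (A : LinOrd2) → (Carrier A → Carrier A) → Set
OrderPreserving A h = ∀ a b → _≤_ A a b → _≤_ A (h a) (h b)

StrictOrderPreserving : (A : LinOrd2) → (Carrier A → Carrier A) → Set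
StrictOrderPreserving A h = ∀ a b → _<_ A a b → _<_ A (h a) (h b)

IsOP : LinOrd2 → Set
IsOP A = OrderPreserving A (f A) × OrderPreserving A (g A)

IsSOP : LinOrd2 → Set
IsSOP A = StrictOrderPreserving A (f A) × StrictOrderPreserving A (g A)

record Embedding (C A : LinOrd2) : Set where
  field
    map       : Carrier C → Carrier A
    injective : Injective _≡_ _≡_ map
    pres-f    : ∀ c → map (f C c) ≡ f A (map c)
    pres-g    : ∀ c → map (g C c) ≡ g A (map c)
    pres-≤    : ∀ c d → _≤_ C c d → _≤_ A (map c) (map d)
    refl-≤    : ∀ c d → _≤_ A (map c) (map d) → _≤_ C c d

open Embedding

AmalgamationProperty : (LinOrd2 → Set) → Set₁
AmalgamationProperty K =
  (A B C : LinOrd2) → K A → K B → K C →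
  (ι₁ : Embedding C A) (ι₂ : Embedding C B) →
  Σ LinOrd2 λ D → K D ×
    Σ (Embedding A D) λ j₁ → Σ (Embedding B D) λ j₂ →
      ∀ c → map j₁ (map ι₁ c) ≡ map j₂ (map ι₂ c)

-- Take the chain C = ℕ with f = g = doubling and embed it by doubling into two
-- chains on ℕ, A and B, that extend the operations differently at the new point
-- 1: in A, f 1 = 2 and g 1 = 3; in B the roles of f and g are swapped. In an
-- amalgam D let x and y be the images of 1 from A and B. As 2 is the image of
-- 1 ∈ C, g x = 3 and g y = 2 in the copy of A, while f y = 3 and f x = 2 in the
-- copy of B. So x ≤ y contradicts monotonicity of g, y ≤ x that of f, and x ≡ y
-- gives g x ≡ g y.
module Submission where

open import Defs
open import Data.Empty using (⊥)
open import Data.Nat using (ℕ; zero; suc; _+_; _≤_; _<_; z≤n; s≤s)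
open import Data.Nat.Properties
  using (≤-isTotalOrder; ≤-antisym; ≤-reflexive; <⇒≤; <⇒≢; <⇒≱; ≮⇒≥; ≤∧≢⇒<;
         <-irrefl; <-trans; ≤-refl; m≤n⇒m<n∨m≡n; n≤1+n; +-monoʳ-<)
open import Data.Product using (_×_; _,_; proj₁)
open import Data.Sum using (inj₁; inj₂)
open import Function using (_∘_)
open import Relation.Binary.Core using (_Preserves_⟶_)
open import Relation.Binary.PropositionalEquality
  using (_≡_; refl; sym; trans; cong; subst₂)
open import Relation.Binary.Structures using (IsTotalOrder)
open import Relation.Nullary using (¬_)

open LinOrd2 using (Carrier; f; g)
open Embedding

MonotoneOnDistinct : (A : LinOrd2) → (Carrier A → Carrier A) → Set
MonotoneOnDistinct A h = ∀ a b → LinOrd2._≤_ A a b → ¬ a ≡ b → LinOrd2._≤_ A (h a) (h b)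

isOP⇒monotoneOnDistinct :
  ∀ D → IsOP D → MonotoneOnDistinct D (f D) × MonotoneOnDistinct D (g D)
isOP⇒monotoneOnDistinct _ (f-op , g-op) =
  (λ a b a≤b _ → f-op a b a≤b) , (λ a b a≤b _ → g-op a b a≤b)

isSOP⇒monotoneOnDistinct :
  ∀ D → IsSOP D → MonotoneOnDistinct D (f D) × MonotoneOnDistinct D (g D)
isSOP⇒monotoneOnDistinct _ (f-sop , g-sop) =
    (λ a b a≤b a≢b → proj₁ (f-sop a b (a≤b , a≢b)))
  , (λ a b a≤b a≢b → proj₁ (g-sop a b (a≤b , a≢b)))

ℕ⟨_,_⟩ : (ℕ → ℕ) → (ℕ → ℕ) → LinOrd2
ℕ⟨ F , G ⟩ = record
  { Carrier = ℕ ; _≤_ = _≤_ ; isTotalOrder = ≤-isTotalOrder ; f = F ; g = G }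

StrictlyIncreasing : (ℕ → ℕ) → Set
StrictlyIncreasing F = F Preserves _<_ ⟶ _<_

strictlyIncreasing-by-steps : ∀ {F} → (∀ n → F n < F (suc n)) → StrictlyIncreasing F
strictlyIncreasing-by-steps {F} step {m} {suc n} (s≤s m≤n) with m≤n⇒m<n∨m≡n m≤n
... | inj₁ m<n  = <-trans (strictlyIncreasing-by-steps step m<n) (step n)
... | inj₂ refl = step m

module _ {F : ℕ → ℕ} (increasing : StrictlyIncreasing F) where

  strictlyIncreasing⇒monotone : ∀ {m n} → m ≤ n → F m ≤ F n
  strictlyIncreasing⇒monotone m≤n with m≤n⇒m<n∨m≡n m≤n
  ... | inj₁ m<n  = <⇒≤ (increasing m<n)
  ... | inj₂ refl = ≤-refl

  strictlyIncreasing⇒reflects-≤ : ∀ {m n} → F m ≤ F n → m ≤ n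
  strictlyIncreasing⇒reflects-≤ Fm≤Fn = ≮⇒≥ λ n<m → <⇒≱ (increasing n<m) Fm≤Fn

  strictlyIncreasing⇒injective : ∀ {m n} → F m ≡ F n → m ≡ n
  strictlyIncreasing⇒injective e = ≤-antisym
    (strictlyIncreasing⇒reflects-≤ (≤-reflexive e))
    (strictlyIncreasing⇒reflects-≤ (≤-reflexive (sym e)))

isOP-ℕ : ∀ {F G} → StrictlyIncreasing F → StrictlyIncreasing G → IsOP ℕ⟨ F , G ⟩
isOP-ℕ incF incG =
    (λ _ _ → strictlyIncreasing⇒monotone incF)
  , (λ _ _ → strictlyIncreasing⇒monotone incG)

isSOP-ℕ : ∀ {F G} → StrictlyIncreasing F → StrictlyIncreasing G → IsSOP ℕ⟨ F , G ⟩
isSOP-ℕ {F} {G} incF incG = preserves incF , preserves incG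
  where
  preserves : ∀ {H} → StrictlyIncreasing H → StrictOrderPreserving ℕ⟨ F , G ⟩ H
  preserves incH _ _ (m≤n , m≢n) =
    let Hm<Hn = incH (≤∧≢⇒< m≤n m≢n) in <⇒≤ Hm<Hn , <⇒≢ Hm<Hn

ℕ-embedding : ∀ {F G F′ G′ h} → StrictlyIncreasing h →
  (∀ c → h (F c) ≡ F′ (h c)) → (∀ c → h (G c) ≡ G′ (h c)) →
  Embedding ℕ⟨ F , G ⟩ ℕ⟨ F′ , G′ ⟩
ℕ-embedding {h = h} incH hF hG = record
  { map       = h
  ; injective = strictlyIncreasing⇒injective incH
  ; pres-f    = hF
  ; pres-g    = hG
  ; pres-≤    = λ _ _ → strictlyIncreasing⇒monotone incH
  ; refl-≤    = λ _ _ → strictlyIncreasing⇒reflects-≤ incH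
  }

double : ℕ → ℕ
double zero    = zero
double (suc n) = suc (suc (double n))

twist : ℕ → ℕ
twist zero          = zero
twist (suc zero)    = 3
twist (suc (suc n)) = 4 + twist n

double-increasing : StrictlyIncreasing double
double-increasing = strictlyIncreasing-by-steps λ n → s≤s (n≤1+n (double n))

twist-increasing : StrictlyIncreasing twist
twist-increasing = strictlyIncreasing-by-steps step
  where
  step : ∀ n → twist n < twist (suc n)
  step zero          = s≤s z≤n
  step (suc zero)    = ≤-refl
  step (suc (suc n)) = +-monoʳ-< 4 (step n)

double²≡twist∘double : ∀ n → double (double n) ≡ twist (double n)
double²≡twist∘double zero    = refl
double²≡twist∘double (suc n) = cong (4 +_) (double²≡twist∘double n)

C₀ A₀ B₀ : LinOrd2
C₀ = ℕ⟨ double , double ⟩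
A₀ = ℕ⟨ double , twist ⟩
B₀ = ℕ⟨ twist , double ⟩

double-into-A₀ : Embedding C₀ A₀
double-into-A₀ = ℕ-embedding double-increasing (λ _ → refl) double²≡twist∘double

double-into-B₀ : Embedding C₀ B₀
double-into-B₀ = ℕ-embedding double-increasing double²≡twist∘double (λ _ → refl)

3≰2 : ¬ 3 ≤ 2
3≰2 = <-irrefl refl

module _ (D : LinOrd2)
         (f-mono : MonotoneOnDistinct D (f D)) (g-mono : MonotoneOnDistinct D (g D))
         (j₁ : Embedding A₀ D) (j₂ : Embedding B₀ D)
         (commutes : ∀ c → map j₁ (map double-into-A₀ c) ≡ map j₂ (map double-into-B₀ c))
         where

  open LinOrd2 D using () renaming (_≤_ to _≤ᴰ_)

  private
    x y : Carrier D
    x = map j₁ 1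
    y = map j₂ 1

    g-x : g D x ≡ map j₁ 3
    g-x = sym (pres-g j₁ 1)

    g-y : g D y ≡ map j₁ 2
    g-y = trans (sym (pres-g j₂ 1)) (sym (commutes 1))

    f-x : f D x ≡ map j₂ 2
    f-x = trans (sym (pres-f j₁ 1)) (commutes 1)

    f-y : f D y ≡ map j₂ 3
    f-y = sym (pres-f j₂ 1)

    x≢y : ¬ x ≡ y
    x≢y x≡y with injective j₁ (trans (sym g-x) (trans (cong (g D) x≡y) g-y))
    ... | ()

    x≰y : ¬ x ≤ᴰ y
    x≰y x≤y = 3≰2 (refl-≤ j₁ 3 2 (subst₂ _≤ᴰ_ g-x g-y (g-mono x y x≤y x≢y)))

    y≰x : ¬ y ≤ᴰ x
    y≰x y≤x = 3≰2 (refl-≤ j₂ 3 2 (subst₂ _≤ᴰ_ f-y f-x (f-mono y x y≤x (x≢y ∘ sym))))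

  no-amalgam-of-A₀-and-B₀ : ⊥
  no-amalgam-of-A₀-and-B₀ with IsTotalOrder.total (LinOrd2.isTotalOrder D) x y
  ... | inj₁ x≤y = x≰y x≤y
  ... | inj₂ y≤x = y≰x y≤x

¬amalgamation : (K : LinOrd2 → Set) →
  (∀ D → K D → MonotoneOnDistinct D (f D) × MonotoneOnDistinct D (g D)) →
  K A₀ → K B₀ → K C₀ → ¬ AmalgamationProperty K
¬amalgamation K monotone kA kB kC amalgamate =
  let D , kD , j₁ , j₂ , commutes = amalgamate A₀ B₀ C₀ kA kB kC double-into-A₀ double-into-B₀
      f-mono , g-mono = monotone D kD
  in  no-amalgam-of-A₀-and-B₀ D f-mono g-mono j₁ j₂ commutes

theorem3p1 : ¬ AmalgamationProperty IsOP × ¬ AmalgamationProperty IsSOP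
theorem3p1 =
    ¬amalgamation IsOP
      isOP⇒monotoneOnDistinct
      (isOP-ℕ double-increasing twist-increasing)
      (isOP-ℕ twist-increasing double-increasing)
      (isOP-ℕ double-increasing double-increasing)
  , ¬amalgamation IsSOP
      isSOP⇒monotoneOnDistinct
      (isSOP-ℕ double-increasing twist-increasing)
      (isSOP-ℕ twist-increasing double-increasing)
      (isSOP-ℕ double-increasing double-increasing)
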